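{- Let $G$ be a finite group with conjugacy classes $C_1,\dots,C_r$, and let $H$ be a subgroup of $G$. Then $$|\Theta^G_H|=\frac1{|H|}\sum_{i=1}^r|H\cap C_i|\cdot \operatorname{Sq}(C_i),$$ where $\operatorname{Sq}(C_i)$ denotes the number of square roots in $G$ (i.e. the number of $x\in G$ with $x^2=g$) of any element $g\in C_i$.
   Context: For a subgroup $H$ of $G$, the double cosets $HgH$ ($g\in G$) partition $G$. The inverse of the double coset $HgH$ is the double coset $Hg^{ -1}H$ (the set of inverses of its elements). A double coset is self-inverse if it equals its inverse. $\Theta^G_H$ denotes the set of self-inverse double cosets in $H\backslash G/H$. -}

module Defs where

open import Data.Nat using (ℕ; _*_)
open import Data.List using (List; length; filter)
open import Data.List.Membership.Propositional using (_∈_)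
open import Data.List.Relation.Unary.Any as Any using (Any; any?)
open import Data.List.Relation.Unary.All using (All)
open import Data.List.Relation.Unary.AllPairs using (AllPairs)
open import Data.List.Relation.Unary.Unique.Propositional using (Unique)
open import Data.Product using (Σ; _×_; _,_)
open import Data.Product.Properties using ()
open import Relation.Nullary using (Dec; yes; no; ¬_)
open import Relation.Nullary.Decidable using (_×-dec_)
open import Relation.Unary using (Pred; Decidable)
open import Relation.Binary.PropositionalEquality using (_≡_; subst)
open import Relation.Binary.Definitions using (DecidableEquality)
open import Algebra.Structures using (IsGroup)
open import Function.Bundles using (_⇔_)

record FiniteGroup : Set₁ where
  infixl 7 _∙_
  field
    Carrier  : Set
    _∙_      : Carrier → Carrier → Carrier
    ε        : Carrier
    _⁻¹      : Carrier → Carrier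
    isGroup  : IsGroup _≡_ _∙_ ε _⁻¹
    _≟_      : DecidableEquality Carrier
    elements : List Carrier
    complete : ∀ x → x ∈ elements
    unique   : Unique elements

  ∃? : (P : Carrier → Set) → Decidable P → Dec (Σ Carrier P)
  ∃? P P? with any? P? elements
  ... | yes a = yes (Any.satisfied a)
  ... | no ¬a = no λ { (x , px) → ¬a (Any.map (λ eq → subst P eq px) (complete x)) }

  count : {P : Carrier → Set} → Decidable P → ℕ
  count P? = length (filter P? elements)

  Conj : Carrier → Carrier → Set
  Conj x y = Σ Carrier λ g → y ≡ (g ∙ x) ∙ (g ⁻¹)

  Conj? : ∀ x y → Dec (Conj x y)
  Conj? x y = ∃? (λ g → y ≡ (g ∙ x) ∙ (g ⁻¹)) (λ g → y ≟ ((g ∙ x) ∙ (g ⁻¹)))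

  Sq : Carrier → ℕ
  Sq g = count (λ x → (x ∙ x) ≟ g)

record Subgroup (G : FiniteGroup) : Set₁ where
  open FiniteGroup G
  field
    member  : Carrier → Set
    member? : Decidable member
    ε∈      : member ε
    ∙∈      : ∀ {x y} → member x → member y → member (x ∙ y)
    ⁻¹∈     : ∀ {x} → member x → member (x ⁻¹)

module _ {G : FiniteGroup} (H : Subgroup G) where
  open FiniteGroup G
  open Subgroup H

  order : ℕ
  order = count member?

  InDC : Carrier → Carrier → Set
  InDC x y = Σ Carrier λ h₁ → Σ Carrier λ h₂ →
               member h₁ × member h₂ × (y ≡ (h₁ ∙ x) ∙ h₂)

  SelfInverse : Carrier → Set
  SelfInverse g = ∀ y → InDC g y ⇔ InDC (g ⁻¹) y

  -- a list of representatives of the distinct self-inverse double cosets,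
  -- i.e. an enumeration of Θ^G_H
  IsThetaReps : List Carrier → Set
  IsThetaReps rs = All SelfInverse rs
                 × AllPairs (λ a b → ¬ InDC a b) rs
                 × (∀ g → SelfInverse g → Any (λ r → InDC r g) rs)

  countHC : Carrier → ℕ
  countHC c = count (λ h → member? h ×-dec Conj? c h)

IsClassReps : (G : FiniteGroup) → List (FiniteGroup.Carrier G) → Set
IsClassReps G cs = AllPairs (λ a b → ¬ Conj a b) cs × (∀ g → Any (λ c → Conj c g) cs)
  where open FiniteGroup G

-- Both sides count the x ∈ G with x² ∈ H.
--
-- Right side: Sq is a class function, so the class sum is ∑_{h ∈ H} Sq(h),
-- which counts these x by the fibres of squaring.
--
-- Left side: x² ∈ H gives x = x⁻¹ · x² ∈ Hx⁻¹H, so HxH is self-inverse, and it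
-- remains to see that a self-inverse D = HrH contains exactly |H| such x.
-- Counting pairs (x, a) with a ∈ D and x ∈ aH ∩ Ha⁻¹ in two ways gives
-- |H| · #{x ∈ D : x² ∈ H} = ∑_{a ∈ D} |aH ∩ Ha⁻¹|.  Since |aH ∩ Hb⁻¹| only
-- depends on HbH and a ∈ D = Hr⁻¹H, each term equals |aH ∩ Hr|; and every
-- x ∈ Hr lies in aH for exactly |H| elements a, all of them in D, so the sum
-- is |H|².
module Submission where

open import Defs
open import Level using (0ℓ)
open import Algebra.Bundles using (Group)
import Algebra.Properties.Group as GroupProperties
import Algebra.Properties.Monoid as MonoidProperties
open import Data.Empty using (⊥-elim)
open import Data.Nat using (ℕ; suc; _+_; _*_; NonZero)
open import Data.Nat.Properties
  using (*-comm; *-identityˡ; *-identityʳ; *-zeroʳ; *-distribˡ-+; *-cancelʳ-≡; +-commutativeSemigroup)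
open import Algebra.Properties.CommutativeSemigroup +-commutativeSemigroup using (interchange)
open import Data.Nat.ListAction using (sum)
open import Data.List using (List; []; _∷_; length; map; filter)
open import Data.List.Properties using (map-cong)
open import Data.List.Membership.Propositional using (_∈_)
open import Data.List.Membership.Propositional.Properties using (∈-filter⁺)
open import Data.List.Relation.Unary.Any as Any using (Any; here; there)
open import Data.List.Relation.Unary.All as All using (All; []; _∷_)
open import Data.List.Relation.Unary.AllPairs using (AllPairs; []; _∷_)
open import Data.Product using (_×_; _,_)
open import Data.Product.Function.NonDependent.Propositional using (_×-⇔_)
open import Function.Bundles using (_⇔_; mk⇔; Equivalence)
open import Function.Construct.Identity using (⇔-id)
open import Relation.Nullary using (Dec; yes; no; ¬_)
open import Relation.Nullary.Decidable using (_×-dec_)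
open import Relation.Unary using (Decidable)
open import Relation.Binary.Definitions using (Symmetric; Transitive)
open import Relation.Binary.PropositionalEquality
  using (_≡_; refl; sym; trans; cong; cong₂; subst; module ≡-Reasoning)

open ≡-Reasoning

private
  variable
    A B : Set
    P Q P′ Q′ : Set

𝟙 : Dec P → ℕ
𝟙 (yes _) = 1
𝟙 (no _)  = 0

𝟙-cong : P ⇔ Q → (p : Dec P) (q : Dec Q) → 𝟙 p ≡ 𝟙 q
𝟙-cong _   (yes _) (yes _) = refl
𝟙-cong P⇔Q (yes p) (no ¬q) = ⊥-elim (¬q (Equivalence.to P⇔Q p))
𝟙-cong P⇔Q (no ¬p) (yes q) = ⊥-elim (¬p (Equivalence.from P⇔Q q))
𝟙-cong _   (no _)  (no _)  = refl

𝟙-× : (p : Dec P) (q : Dec Q) → 𝟙 (p ×-dec q) ≡ 𝟙 p * 𝟙 q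
𝟙-× (yes _) (yes _) = refl
𝟙-× (yes _) (no _)  = refl
𝟙-× (no _)  _       = refl

𝟙-*-cong : (P × Q) ⇔ (P′ × Q′) →
           (p : Dec P) (q : Dec Q) (p′ : Dec P′) (q′ : Dec Q′) → 𝟙 p * 𝟙 q ≡ 𝟙 p′ * 𝟙 q′
𝟙-*-cong e p q p′ q′ = begin
  𝟙 p * 𝟙 q           ≡⟨ 𝟙-× p q ⟨
  𝟙 (p ×-dec q)       ≡⟨ 𝟙-cong e (p ×-dec q) (p′ ×-dec q′) ⟩
  𝟙 (p′ ×-dec q′)     ≡⟨ 𝟙-× p′ q′ ⟩
  𝟙 p′ * 𝟙 q′         ∎

𝟙-*-congˡ : ∀ {m n} → (P → m ≡ n) → (p : Dec P) → 𝟙 p * m ≡ 𝟙 p * n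
𝟙-*-congˡ m≡n (yes p) = cong (1 *_) (m≡n p)
𝟙-*-congˡ _   (no _)  = refl

∑ : List A → (A → ℕ) → ℕ
∑ xs f = sum (map f xs)

infix 5 ∑
syntax ∑ xs (λ x → e) = ∑[ x ← xs ] e

∑-cong : ∀ (xs : List A) {f g : A → ℕ} → (∀ x → f x ≡ g x) → ∑ xs f ≡ ∑ xs g
∑-cong xs f≗g = cong sum (map-cong f≗g xs)

∑-+ : ∀ (xs : List A) (f g : A → ℕ) → ∑[ x ← xs ] (f x + g x) ≡ ∑ xs f + ∑ xs g
∑-+ []       f g = refl
∑-+ (x ∷ xs) f g =
  trans (cong (f x + g x +_) (∑-+ xs f g)) (interchange (f x) (g x) (∑ xs f) (∑ xs g))

∑-*ˡ : ∀ (xs : List A) c (f : A → ℕ) → ∑[ x ← xs ] c * f x ≡ c * ∑ xs f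
∑-*ˡ []       c f = sym (*-zeroʳ c)
∑-*ˡ (x ∷ xs) c f =
  trans (cong (c * f x +_) (∑-*ˡ xs c f)) (sym (*-distribˡ-+ c (f x) (∑ xs f)))

∑-*ʳ : ∀ (xs : List A) c (f : A → ℕ) → ∑[ x ← xs ] f x * c ≡ ∑ xs f * c
∑-*ʳ xs c f = trans (∑-cong xs (λ x → *-comm (f x) c)) (trans (∑-*ˡ xs c f) (*-comm c (∑ xs f)))

∑-const : ∀ {xs : List A} {f : A → ℕ} {c} → All (λ x → f x ≡ c) xs → ∑ xs f ≡ length xs * c
∑-const []           = refl
∑-const (fx≡c ∷ f≡c) = cong₂ _+_ fx≡c (∑-const f≡c)

∑-swap : ∀ (xs : List A) (ys : List B) (f : A → B → ℕ) →
         ∑[ x ← xs ] ∑[ y ← ys ] f x y ≡ ∑[ y ← ys ] ∑[ x ← xs ] f x y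
∑-swap []       ys f = sym (∑-zero ys)
  where
  ∑-zero : ∀ (ys : List B) → ∑[ y ← ys ] 0 ≡ 0
  ∑-zero []       = refl
  ∑-zero (_ ∷ ys) = ∑-zero ys
∑-swap (x ∷ xs) ys f = begin
  ∑ ys (f x) + (∑[ x′ ← xs ] ∑[ y ← ys ] f x′ y) ≡⟨ cong (∑ ys (f x) +_) (∑-swap xs ys f) ⟩
  ∑ ys (f x) + (∑[ y ← ys ] ∑[ x′ ← xs ] f x′ y) ≡⟨ ∑-+ ys (f x) _ ⟨
  ∑[ y ← ys ] (f x y + (∑[ x′ ← xs ] f x′ y))    ∎

∑-*ˡ-swap : ∀ (xs : List A) (ys : List B) (c : A → ℕ) (f : A → B → ℕ) →
            ∑[ x ← xs ] c x * (∑[ y ← ys ] f x y) ≡ ∑[ y ← ys ] ∑[ x ← xs ] c x * f x y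
∑-*ˡ-swap xs ys c f = trans (∑-cong xs (λ x → sym (∑-*ˡ ys (c x) (f x)))) (∑-swap xs ys _)

count≡∑ : ∀ {P : A → Set} (P? : Decidable P) xs → length (filter P? xs) ≡ ∑[ x ← xs ] 𝟙 (P? x)
count≡∑ P? []       = refl
count≡∑ P? (x ∷ xs) with P? x
... | yes _ = cong suc (count≡∑ P? xs)
... | no _  = count≡∑ P? xs

module _ {R : A → A → Set} (R? : ∀ a b → Dec (R a b)) {y : A} where

  ∑-𝟙-none : ∀ xs → All (λ c → ¬ R c y) xs → ∑[ c ← xs ] 𝟙 (R? c y) ≡ 0
  ∑-𝟙-none []       []            = refl
  ∑-𝟙-none (x ∷ xs) (x≁y ∷ xs≁y) with R? x y
  ... | yes x∼y = ⊥-elim (x≁y x∼y)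
  ... | no _    = ∑-𝟙-none xs xs≁y

  ∑-𝟙-unique : Symmetric R → Transitive R →
               ∀ xs → AllPairs (λ a b → ¬ R a b) xs → Any (λ c → R c y) xs → ∑[ c ← xs ] 𝟙 (R? c y) ≡ 1
  ∑-𝟙-unique R-sym R-trans (x ∷ xs) (x≁xs ∷ xs-apart) y∈xs with R? x y
  ... | yes x∼y = cong suc (∑-𝟙-none xs (All.map (λ x≁c c∼y → x≁c (R-trans x∼y (R-sym c∼y))) x≁xs))
  ... | no x≁y  = ∑-𝟙-unique R-sym R-trans xs xs-apart (Any.tail x≁y y∈xs)

module Counting (G : FiniteGroup) where
  open FiniteGroup G

  private
    group : Group 0ℓ 0ℓ
    group = record
      { Carrier = Carrier ; _≈_ = _≡_ ; _∙_ = _∙_ ; ε = ε ; _⁻¹ = _⁻¹ ; isGroup = isGroup }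

  open Group group using (assoc; identityˡ; identityʳ; inverseˡ; inverseʳ)
  open GroupProperties group using (ε⁻¹≈ε; ⁻¹-involutive; ⁻¹-anti-homo-∙)
  open MonoidProperties (Group.monoid group) using (cancelˡ; cancelʳ; cancelᶜ; [u∙vw]x≈uv∙wx)

  ∑ᴳ : (Carrier → ℕ) → ℕ
  ∑ᴳ = ∑ elements

  infix 5 ∑ᴳ
  syntax ∑ᴳ (λ x → e) = ∑[ x ] e

  ∑-δ : ∀ a (f : Carrier → ℕ) → ∑[ y ] 𝟙 (y ≟ a) * f y ≡ f a
  ∑-δ a f = begin
    ∑[ y ] 𝟙 (y ≟ a) * f y     ≡⟨ ∑-cong elements (λ y → 𝟙-*-congˡ (cong f) (y ≟ a)) ⟩
    ∑[ y ] 𝟙 (y ≟ a) * f a     ≡⟨ ∑-*ʳ elements (f a) (λ y → 𝟙 (y ≟ a)) ⟩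
    (∑[ y ] 𝟙 (y ≟ a)) * f a   ≡⟨ cong (_* f a) (∑-𝟙-unique _≟_ sym trans elements unique a∈G) ⟩
    1 * f a                    ≡⟨ *-identityˡ (f a) ⟩
    f a                        ∎
    where
    a∈G : Any (_≡ a) elements
    a∈G = Any.map sym (complete a)

  ∑-reindex : ∀ (σ τ : Carrier → Carrier) → (∀ y → σ (τ y) ≡ y) → (∀ x → τ (σ x) ≡ x) →
              ∀ f → ∑[ x ] f (σ x) ≡ ∑ᴳ f
  ∑-reindex σ τ στ τσ f = begin
    ∑[ x ] f (σ x)                    ≡⟨ ∑-cong elements (λ x → ∑-δ (σ x) f) ⟨
    ∑[ x ] ∑[ y ] 𝟙 (y ≟ σ x) * f y   ≡⟨ ∑-swap elements elements (λ x y → 𝟙 (y ≟ σ x) * f y) ⟩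
    ∑[ y ] ∑[ x ] 𝟙 (y ≟ σ x) * f y   ≡⟨ ∑-cong elements (λ y → ∑-cong elements (λ x →
                                           cong (_* f y) (𝟙-cong σ⁻¹ (y ≟ σ x) (x ≟ τ y)))) ⟩
    ∑[ y ] ∑[ x ] 𝟙 (x ≟ τ y) * f y   ≡⟨ ∑-cong elements (λ y → ∑-δ (τ y) (λ _ → f y)) ⟩
    ∑ᴳ f                              ∎
    where
    σ⁻¹ : ∀ {x y} → y ≡ σ x ⇔ x ≡ τ y
    σ⁻¹ {x} {y} = mk⇔ (λ y≡σx → trans (sym (τσ x)) (cong τ (sym y≡σx)))
                      (λ x≡τy → trans (sym (στ y)) (cong σ (sym x≡τy)))

  ∑-∙ˡ : ∀ g f → ∑[ x ] f (g ∙ x) ≡ ∑ᴳ f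
  ∑-∙ˡ g = ∑-reindex (g ∙_) (g ⁻¹ ∙_) (cancelˡ (inverseʳ g)) (cancelˡ (inverseˡ g))

  ∑-∙ʳ : ∀ g f → ∑[ x ] f (x ∙ g) ≡ ∑ᴳ f
  ∑-∙ʳ g = ∑-reindex (_∙ g) (_∙ g ⁻¹) (cancelʳ (inverseˡ g)) (cancelʳ (inverseʳ g))

  ∑-fibres : ∀ (φ : Carrier → Carrier) (f : Carrier → ℕ) →
             ∑[ y ] f y * count (λ x → φ x ≟ y) ≡ ∑[ x ] f (φ x)
  ∑-fibres φ f = begin
    ∑[ y ] f y * count (λ x → φ x ≟ y)   ≡⟨ ∑-cong elements (λ y → cong (f y *_) (count≡∑ _ elements)) ⟩
    ∑[ y ] f y * (∑[ x ] 𝟙 (φ x ≟ y))    ≡⟨ ∑-*ˡ-swap elements elements f (λ y x → 𝟙 (φ x ≟ y)) ⟩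
    ∑[ x ] ∑[ y ] f y * 𝟙 (φ x ≟ y)      ≡⟨ ∑-cong elements (λ x → ∑-cong elements (flip x)) ⟩
    ∑[ x ] ∑[ y ] 𝟙 (y ≟ φ x) * f y      ≡⟨ ∑-cong elements (λ x → ∑-δ (φ x) f) ⟩
    ∑[ x ] f (φ x)                       ∎
    where
    flip : ∀ x y → f y * 𝟙 (φ x ≟ y) ≡ 𝟙 (y ≟ φ x) * f y
    flip x y = trans (*-comm (f y) _) (cong (_* f y) (𝟙-cong (mk⇔ sym sym) (φ x ≟ y) (y ≟ φ x)))

  ∙-sandwich : ∀ k g x g′ k′ → k ∙ (g ∙ x ∙ g′) ∙ k′ ≡ (k ∙ g) ∙ x ∙ (g′ ∙ k′)
  ∙-sandwich k g x g′ k′ =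
    trans ([u∙vw]x≈uv∙wx k (g ∙ x) g′ k′) (cong (_∙ (g′ ∙ k′)) (sym (assoc k g x)))

  sandwich-cancel : ∀ {k g g′ k′} x → k ∙ g ≡ ε → g′ ∙ k′ ≡ ε → k ∙ (g ∙ x ∙ g′) ∙ k′ ≡ x
  sandwich-cancel {k} {g} {g′} {k′} x kg≡ε g′k′≡ε = begin
    k ∙ (g ∙ x ∙ g′) ∙ k′      ≡⟨ ∙-sandwich k g x g′ k′ ⟩
    (k ∙ g) ∙ x ∙ (g′ ∙ k′)    ≡⟨ cong₂ (λ u v → u ∙ x ∙ v) kg≡ε g′k′≡ε ⟩
    ε ∙ x ∙ ε                  ≡⟨ identityʳ (ε ∙ x) ⟩
    ε ∙ x                      ≡⟨ identityˡ x ⟩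
    x                          ∎

  conj : Carrier → Carrier → Carrier
  conj g x = g ∙ x ∙ g ⁻¹

  conj-comp : ∀ k g x → conj (k ∙ g) x ≡ conj k (conj g x)
  conj-comp k g x = begin
    (k ∙ g) ∙ x ∙ (k ∙ g) ⁻¹        ≡⟨ cong ((k ∙ g) ∙ x ∙_) (⁻¹-anti-homo-∙ k g) ⟩
    (k ∙ g) ∙ x ∙ (g ⁻¹ ∙ k ⁻¹)     ≡⟨ ∙-sandwich k g x (g ⁻¹) (k ⁻¹) ⟨
    k ∙ (g ∙ x ∙ g ⁻¹) ∙ k ⁻¹       ∎

  conj-cancel : ∀ {g g′} x → g ∙ g′ ≡ ε → conj g (conj g′ x) ≡ x
  conj-cancel {g} {g′} x gg′≡ε = sandwich-cancel x gg′≡ε g′⁻¹g⁻¹≡ε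
    where
    g′⁻¹g⁻¹≡ε : g′ ⁻¹ ∙ g ⁻¹ ≡ ε
    g′⁻¹g⁻¹≡ε = trans (sym (⁻¹-anti-homo-∙ g g′)) (trans (cong _⁻¹ gg′≡ε) ε⁻¹≈ε)

  conj-injective : ∀ g {x y} → conj g x ≡ conj g y → x ≡ y
  conj-injective g {x} {y} e = begin
    x                           ≡⟨ conj-cancel x (inverseˡ g) ⟨
    conj (g ⁻¹) (conj g x)      ≡⟨ cong (conj (g ⁻¹)) e ⟩
    conj (g ⁻¹) (conj g y)      ≡⟨ conj-cancel y (inverseˡ g) ⟩
    y                           ∎

  conj-homo-∙ : ∀ g x y → conj g (x ∙ y) ≡ conj g x ∙ conj g y
  conj-homo-∙ g x y = begin
    g ∙ (x ∙ y) ∙ g ⁻¹                 ≡⟨ [u∙vw]x≈uv∙wx g x y (g ⁻¹) ⟩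
    (g ∙ x) ∙ (y ∙ g ⁻¹)               ≡⟨ cancelᶜ (inverseˡ g) (g ∙ x) (y ∙ g ⁻¹) ⟨
    conj g x ∙ (g ∙ (y ∙ g ⁻¹))        ≡⟨ cong (conj g x ∙_) (sym (assoc g y (g ⁻¹))) ⟩
    conj g x ∙ conj g y                ∎

  Conj-sym : Symmetric Conj
  Conj-sym {x} {y} (g , y≡gxg⁻¹) =
    g ⁻¹ , trans (sym (conj-cancel x (inverseˡ g))) (cong (conj (g ⁻¹)) (sym y≡gxg⁻¹))

  Conj-trans : Transitive Conj
  Conj-trans {x} (g , y≡gxg⁻¹) (k , z≡kyk⁻¹) =
    k ∙ g , trans z≡kyk⁻¹ (trans (cong (conj k) y≡gxg⁻¹) (sym (conj-comp k g x)))

  Sq-conj : ∀ g c → Sq (conj g c) ≡ Sq c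
  Sq-conj g c = begin
    Sq (conj g c)                                    ≡⟨ count≡∑ _ elements ⟩
    ∑[ x ] 𝟙 ((x ∙ x) ≟ conj g c)                    ≡⟨ ∑-reindex (conj g) (conj (g ⁻¹))
                                                          (λ y → conj-cancel y (inverseʳ g))
                                                          (λ x → conj-cancel x (inverseˡ g))
                                                          (λ y → 𝟙 ((y ∙ y) ≟ conj g c)) ⟨
    ∑[ x ] 𝟙 ((conj g x ∙ conj g x) ≟ conj g c)      ≡⟨ ∑-cong elements (λ x → 𝟙-cong (squares x) _ _) ⟩
    ∑[ x ] 𝟙 ((x ∙ x) ≟ c)                           ≡⟨ count≡∑ _ elements ⟨
    Sq c                                             ∎
    where
    squares : ∀ x → conj g x ∙ conj g x ≡ conj g c ⇔ x ∙ x ≡ c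
    squares x = mk⇔ (λ e → conj-injective g (trans (conj-homo-∙ g x x) e))
                    (λ e → trans (sym (conj-homo-∙ g x x)) (cong (conj g) e))

  ∑-classReps : ∀ {cs} → IsClassReps G cs → {P : Carrier → Set} (P? : Decidable P)
                (f : Carrier → ℕ) → (∀ g c → f (conj g c) ≡ f c) →
                ∑[ c ← cs ] count (λ h → P? h ×-dec Conj? c h) * f c ≡ ∑[ h ] 𝟙 (P? h) * f h
  ∑-classReps {cs} (cs-apart , cs-cover) {P} P? f f-conj = begin
    ∑[ c ← cs ] count (λ h → P? h ×-dec Conj? c h) * f c
      ≡⟨ ∑-cong cs (λ c → trans (cong (_* f c) (count≡∑ _ elements))
                                (sym (∑-*ʳ elements (f c) (λ h → 𝟙 (P? h ×-dec Conj? c h))))) ⟩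
    ∑[ c ← cs ] ∑[ h ] 𝟙 (P? h ×-dec Conj? c h) * f c
      ≡⟨ ∑-cong cs (λ c → ∑-cong elements (λ h → evaluate-at-h (P? h) (Conj? c h))) ⟩
    ∑[ c ← cs ] ∑[ h ] (𝟙 (P? h) * f h) * 𝟙 (Conj? c h)
      ≡⟨ ∑-swap cs elements (λ c h → (𝟙 (P? h) * f h) * 𝟙 (Conj? c h)) ⟩
    ∑[ h ] ∑[ c ← cs ] (𝟙 (P? h) * f h) * 𝟙 (Conj? c h)
      ≡⟨ ∑-cong elements (λ h → trans (∑-*ˡ cs (𝟙 (P? h) * f h) (λ c → 𝟙 (Conj? c h)))
           (cong (𝟙 (P? h) * f h *_) (∑-𝟙-unique Conj? Conj-sym Conj-trans cs cs-apart (cs-cover h)))) ⟩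
    ∑[ h ] (𝟙 (P? h) * f h) * 1
      ≡⟨ ∑-cong elements (λ h → *-identityʳ _) ⟩
    ∑[ h ] 𝟙 (P? h) * f h
      ∎
    where
    evaluate-at-h : ∀ {c h} (p : Dec (P h)) (q : Dec (Conj c h)) →
                    𝟙 (p ×-dec q) * f c ≡ (𝟙 p * f h) * 𝟙 q
    evaluate-at-h {c}     (yes _) (yes (g , refl)) =
      trans (cong (1 *_) (sym (f-conj g c))) (sym (*-identityʳ _))
    evaluate-at-h {h = h} (yes _) (no _)  = sym (*-zeroʳ (1 * f h))
    evaluate-at-h         (no _)  (yes _) = refl
    evaluate-at-h         (no _)  (no _)  = refl

  module _ (H : Subgroup G) where
    open Subgroup H renaming (member to infix 4 _∈H; member? to infix 4 _∈H?)

    ∈H-∙ʳ : ∀ {h x} → h ∈H → (x ∙ h ∈H ⇔ x ∈H)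
    ∈H-∙ʳ {h} {x} h∈H =
      mk⇔ (λ xh∈H → subst _∈H (cancelʳ (inverseʳ h) x) (∙∈ xh∈H (⁻¹∈ h∈H))) (λ x∈H → ∙∈ x∈H h∈H)

    ∈H-⁻¹ : ∀ {x} → (x ⁻¹ ∈H ⇔ x ∈H)
    ∈H-⁻¹ {x} = mk⇔ (λ x⁻¹∈H → subst _∈H (⁻¹-involutive x) (⁻¹∈ x⁻¹∈H)) ⁻¹∈

    ∈H-∙∙ʳ : ∀ {h} x y → h ∈H → (x ∙ (y ∙ h) ∈H ⇔ x ∙ y ∈H)
    ∈H-∙∙ʳ {h} x y h∈H rewrite sym (assoc x y h) = ∈H-∙ʳ h∈H

    [xh]⁻¹x∈H⇔h∈H : ∀ x h → ((x ∙ h) ⁻¹ ∙ x ∈H ⇔ h ∈H)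
    [xh]⁻¹x∈H⇔h∈H x h rewrite ⁻¹-anti-homo-∙ x h | cancelʳ (inverseˡ x) (h ⁻¹) = ∈H-⁻¹

    order≡∑ : order H ≡ ∑[ h ] 𝟙 (h ∈H?)
    order≡∑ = count≡∑ _∈H? elements

    order-nonZero : NonZero (order H)
    order-nonZero = nonEmpty (∈-filter⁺ _∈H? (complete ε) ε∈)
      where
      nonEmpty : ∀ {ys : List Carrier} → ε ∈ ys → NonZero (length ys)
      nonEmpty (here _)  = _
      nonEmpty (there _) = _

    ∑-leftCosets : ∀ x → ∑[ a ] 𝟙 (a ⁻¹ ∙ x ∈H?) ≡ order H
    ∑-leftCosets x = begin
      ∑[ a ] 𝟙 (a ⁻¹ ∙ x ∈H?)          ≡⟨ ∑-∙ˡ x (λ a → 𝟙 (a ⁻¹ ∙ x ∈H?)) ⟨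
      ∑[ h ] 𝟙 ((x ∙ h) ⁻¹ ∙ x ∈H?)    ≡⟨ ∑-cong elements (λ h → 𝟙-cong ([xh]⁻¹x∈H⇔h∈H x h) _ _) ⟩
      ∑[ h ] 𝟙 (h ∈H?)                 ≡⟨ order≡∑ ⟨
      order H                          ∎

    ∑-rightCoset : ∀ b → ∑[ x ] 𝟙 (x ∙ b ∈H?) ≡ order H
    ∑-rightCoset b = begin
      ∑[ x ] 𝟙 (x ∙ b ∈H?)              ≡⟨ ∑-∙ʳ (b ⁻¹) (λ x → 𝟙 (x ∙ b ∈H?)) ⟨
      ∑[ h ] 𝟙 (h ∙ b ⁻¹ ∙ b ∈H?)       ≡⟨ ∑-cong elements (λ h →
                                             cong (λ y → 𝟙 (y ∈H?)) (cancelʳ (inverseˡ b) h)) ⟩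
      ∑[ h ] 𝟙 (h ∈H?)                  ≡⟨ order≡∑ ⟨
      order H                           ∎

    InDC? : ∀ r x → Dec (InDC H r x)
    InDC? r x = ∃? _ (λ h₁ → ∃? _ (λ h₂ → h₁ ∈H? ×-dec h₂ ∈H? ×-dec x ≟ (h₁ ∙ r ∙ h₂)))

    InDC-sym : Symmetric (InDC H)
    InDC-sym {r} (h₁ , h₂ , h₁∈H , h₂∈H , x≡h₁rh₂) =
      h₁ ⁻¹ , h₂ ⁻¹ , ⁻¹∈ h₁∈H , ⁻¹∈ h₂∈H ,
      trans (sym (sandwich-cancel r (inverseˡ h₁) (inverseʳ h₂)))
            (cong (λ y → h₁ ⁻¹ ∙ y ∙ h₂ ⁻¹) (sym x≡h₁rh₂))

    InDC-trans : Transitive (InDC H)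
    InDC-trans (h₁ , h₂ , h₁∈H , h₂∈H , y≡h₁xh₂) (k₁ , k₂ , k₁∈H , k₂∈H , z≡k₁yk₂) =
      k₁ ∙ h₁ , h₂ ∙ k₂ , ∙∈ k₁∈H h₁∈H , ∙∈ h₂∈H k₂∈H ,
      trans z≡k₁yk₂ (trans (cong (λ y → k₁ ∙ y ∙ k₂) y≡h₁xh₂) (∙-sandwich k₁ h₁ _ h₂ k₂))

    InDC-∙ʳ : ∀ {r x h} → h ∈H → (InDC H r (x ∙ h) ⇔ InDC H r x)
    InDC-∙ʳ {r} {x} {h} h∈H = mk⇔ (λ d → subst (InDC H r) (cancelʳ (inverseʳ h) x) (∙ʳ d (⁻¹∈ h∈H)))
                                  (λ d → ∙ʳ d h∈H)
      where
      ∙ʳ : ∀ {y k} → InDC H r y → k ∈H → InDC H r (y ∙ k)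
      ∙ʳ {y} {k} (h₁ , h₂ , h₁∈H , h₂∈H , y≡h₁rh₂) k∈H =
        h₁ , h₂ ∙ k , h₁∈H , ∙∈ h₂∈H k∈H , trans (cong (_∙ k) y≡h₁rh₂) (assoc (h₁ ∙ r) h₂ k)

    sq∈H⇒selfInverse : ∀ {x} → x ∙ x ∈H → SelfInverse H x
    sq∈H⇒selfInverse {x} xx∈H y = mk⇔ (InDC-trans x⁻¹∼x) (InDC-trans (InDC-sym x⁻¹∼x))
      where
      x⁻¹∼x : InDC H (x ⁻¹) x
      x⁻¹∼x = ε , x ∙ x , ε∈ , xx∈H ,
              sym (trans (cong (_∙ (x ∙ x)) (identityˡ (x ⁻¹))) (cancelˡ (inverseˡ x) x))

    cosets-meet⇒InDC : ∀ {r a x} → a ⁻¹ ∙ x ∈H → x ∙ r ⁻¹ ∈H → InDC H r a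
    cosets-meet⇒InDC {r} {a} {x} a⁻¹x∈H xr⁻¹∈H =
      x ∙ r ⁻¹ , (a ⁻¹ ∙ x) ⁻¹ , xr⁻¹∈H , ⁻¹∈ a⁻¹x∈H , sym (begin
      x ∙ r ⁻¹ ∙ r ∙ (a ⁻¹ ∙ x) ⁻¹     ≡⟨ cong (_∙ (a ⁻¹ ∙ x) ⁻¹) (cancelʳ (inverseˡ r) x) ⟩
      x ∙ (a ⁻¹ ∙ x) ⁻¹                ≡⟨ cong (x ∙_) (⁻¹-anti-homo-∙ (a ⁻¹) x) ⟩
      x ∙ (x ⁻¹ ∙ a ⁻¹ ⁻¹)             ≡⟨ cong (λ y → x ∙ (x ⁻¹ ∙ y)) (⁻¹-involutive a) ⟩
      x ∙ (x ⁻¹ ∙ a)                   ≡⟨ cancelˡ (inverseʳ x) a ⟩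
      a                                ∎)

    meet-𝟙 : Carrier → Carrier → Carrier → ℕ
    meet-𝟙 a b x = 𝟙 (a ⁻¹ ∙ x ∈H? ×-dec x ∙ b ∈H?)

    meet : Carrier → Carrier → ℕ
    meet a b = ∑[ x ] meet-𝟙 a b x

    meet-∙ʳ : ∀ {a b h} → h ∈H → meet a (b ∙ h) ≡ meet a b
    meet-∙ʳ {a} {b} h∈H = ∑-cong elements (λ x → 𝟙-cong (⇔-id _ ×-⇔ ∈H-∙∙ʳ x b h∈H) _ _)

    meet-∙ˡ : ∀ {a b h} → h ∈H → meet a (h ∙ b) ≡ meet a b
    meet-∙ˡ {a} {b} {h} h∈H = begin
      meet a (h ∙ b)
        ≡⟨ ∑-∙ʳ (h ⁻¹) (meet-𝟙 a (h ∙ b)) ⟨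
      ∑[ x ] 𝟙 (a ⁻¹ ∙ (x ∙ h ⁻¹) ∈H? ×-dec x ∙ h ⁻¹ ∙ (h ∙ b) ∈H?)
        ≡⟨ ∑-cong elements (λ x → 𝟙-cong (∈H-∙∙ʳ (a ⁻¹) x (⁻¹∈ h∈H) ×-⇔ xh⁻¹hb∈H⇔xb∈H x) _ _) ⟩
      meet a b
        ∎
      where
      xh⁻¹hb∈H⇔xb∈H : ∀ x → x ∙ h ⁻¹ ∙ (h ∙ b) ∈H ⇔ x ∙ b ∈H
      xh⁻¹hb∈H⇔xb∈H x rewrite cancelᶜ (inverseˡ h) x b = ⇔-id _

    meet-InDC : ∀ {a b s} → InDC H s b → meet a b ≡ meet a s
    meet-InDC (h₁ , h₂ , h₁∈H , h₂∈H , refl) = trans (meet-∙ʳ h₂∈H) (meet-∙ˡ h₁∈H)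

    ∑-meet-diagonal : ∀ r → ∑[ a ] 𝟙 (InDC? r a) * meet a a
                          ≡ (∑[ x ] 𝟙 (x ∙ x ∈H?) * 𝟙 (InDC? r x)) * order H
    ∑-meet-diagonal r = begin
      ∑[ a ] 𝟙 (InDC? r a) * meet a a
        ≡⟨ ∑-*ˡ-swap elements elements (λ a → 𝟙 (InDC? r a)) (λ a → meet-𝟙 a a) ⟩
      ∑[ x ] ∑[ a ] 𝟙 (InDC? r a) * meet-𝟙 a a x
        ≡⟨ ∑-cong elements (λ x → ∑-∙ˡ x (λ a → 𝟙 (InDC? r a) * meet-𝟙 a a x)) ⟨
      ∑[ x ] ∑[ h ] 𝟙 (InDC? r (x ∙ h)) * meet-𝟙 (x ∙ h) (x ∙ h) x
        ≡⟨ ∑-cong elements (λ x → ∑-cong elements (regroup x)) ⟩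
      ∑[ x ] ∑[ h ] sq∈H∩HrH x * 𝟙 (h ∈H?)
        ≡⟨ ∑-cong elements (λ x → trans (∑-*ˡ elements (sq∈H∩HrH x) (λ h → 𝟙 (h ∈H?)))
                                        (cong (sq∈H∩HrH x *_) (sym order≡∑))) ⟩
      ∑[ x ] sq∈H∩HrH x * order H
        ≡⟨ ∑-*ʳ elements (order H) sq∈H∩HrH ⟩
      (∑[ x ] sq∈H∩HrH x) * order H
        ∎
      where
      sq∈H∩HrH : Carrier → ℕ
      sq∈H∩HrH x = 𝟙 (x ∙ x ∈H?) * 𝟙 (InDC? r x)

      regroup : ∀ x h → 𝟙 (InDC? r (x ∙ h)) * meet-𝟙 (x ∙ h) (x ∙ h) x ≡ sq∈H∩HrH x * 𝟙 (h ∈H?)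
      regroup x h = begin
        𝟙 (InDC? r (x ∙ h)) * meet-𝟙 (x ∙ h) (x ∙ h) x
          ≡⟨ 𝟙-*-cong (mk⇔ forth back) (InDC? r (x ∙ h)) ((x ∙ h) ⁻¹ ∙ x ∈H? ×-dec x ∙ (x ∙ h) ∈H?)
                                    (x ∙ x ∈H? ×-dec InDC? r x) (h ∈H?) ⟩
        𝟙 (x ∙ x ∈H? ×-dec InDC? r x) * 𝟙 (h ∈H?)
          ≡⟨ cong (_* 𝟙 (h ∈H?)) (𝟙-× (x ∙ x ∈H?) (InDC? r x)) ⟩
        sq∈H∩HrH x * 𝟙 (h ∈H?)
          ∎
        where
        open Equivalence
        forth : InDC H r (x ∙ h) × ((x ∙ h) ⁻¹ ∙ x ∈H × x ∙ (x ∙ h) ∈H) → (x ∙ x ∈H × InDC H r x) × h ∈H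
        forth (d , l , s) = (to (∈H-∙∙ʳ x x h∈H) s , to (InDC-∙ʳ h∈H) d) , h∈H
          where h∈H = to ([xh]⁻¹x∈H⇔h∈H x h) l
        back : (x ∙ x ∈H × InDC H r x) × h ∈H → InDC H r (x ∙ h) × ((x ∙ h) ⁻¹ ∙ x ∈H × x ∙ (x ∙ h) ∈H)
        back ((s , d) , h∈H) =
          from (InDC-∙ʳ h∈H) d , from ([xh]⁻¹x∈H⇔h∈H x h) h∈H , from (∈H-∙∙ʳ x x h∈H) s

    ∑-meet-fixed : ∀ r → ∑[ a ] 𝟙 (InDC? r a) * meet a (r ⁻¹) ≡ order H * order H
    ∑-meet-fixed r = begin
      ∑[ a ] 𝟙 (InDC? r a) * meet a (r ⁻¹)
        ≡⟨ ∑-*ˡ-swap elements elements (λ a → 𝟙 (InDC? r a)) (λ a → meet-𝟙 a (r ⁻¹)) ⟩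
      ∑[ x ] ∑[ a ] 𝟙 (InDC? r a) * meet-𝟙 a (r ⁻¹) x
        ≡⟨ ∑-cong elements (λ x → ∑-cong elements (λ a → forget-InDC x a)) ⟩
      ∑[ x ] ∑[ a ] 𝟙 (x ∙ r ⁻¹ ∈H?) * 𝟙 (a ⁻¹ ∙ x ∈H?)
        ≡⟨ ∑-cong elements (λ x → trans (∑-*ˡ elements (𝟙 (x ∙ r ⁻¹ ∈H?)) (λ a → 𝟙 (a ⁻¹ ∙ x ∈H?)))
                                        (cong (𝟙 (x ∙ r ⁻¹ ∈H?) *_) (∑-leftCosets x))) ⟩
      ∑[ x ] 𝟙 (x ∙ r ⁻¹ ∈H?) * order H
        ≡⟨ ∑-*ʳ elements (order H) (λ x → 𝟙 (x ∙ r ⁻¹ ∈H?)) ⟩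
      (∑[ x ] 𝟙 (x ∙ r ⁻¹ ∈H?)) * order H
        ≡⟨ cong (_* order H) (∑-rightCoset (r ⁻¹)) ⟩
      order H * order H
        ∎
      where
      forget-InDC : ∀ x a → 𝟙 (InDC? r a) * meet-𝟙 a (r ⁻¹) x ≡ 𝟙 (x ∙ r ⁻¹ ∈H?) * 𝟙 (a ⁻¹ ∙ x ∈H?)
      forget-InDC x a =
        𝟙-*-cong (mk⇔ (λ (_ , l , k) → k , l) (λ (k , l) → cosets-meet⇒InDC l k , l , k))
                 (InDC? r a) (a ⁻¹ ∙ x ∈H? ×-dec x ∙ r ⁻¹ ∈H?) (x ∙ r ⁻¹ ∈H?) (a ⁻¹ ∙ x ∈H?)

    selfInverse⇒∑-sq∈H : ∀ {r} → SelfInverse H r → ∑[ x ] 𝟙 (x ∙ x ∈H?) * 𝟙 (InDC? r x) ≡ order H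
    selfInverse⇒∑-sq∈H {r} r-selfInverse = *-cancelʳ-≡ _ _ (order H) {{order-nonZero}} (begin
      (∑[ x ] 𝟙 (x ∙ x ∈H?) * 𝟙 (InDC? r x)) * order H   ≡⟨ ∑-meet-diagonal r ⟨
      ∑[ a ] 𝟙 (InDC? r a) * meet a a                    ≡⟨ ∑-cong elements (λ a → 𝟙-*-congˡ meet-r⁻¹ (InDC? r a)) ⟩
      ∑[ a ] 𝟙 (InDC? r a) * meet a (r ⁻¹)               ≡⟨ ∑-meet-fixed r ⟩
      order H * order H                                  ∎)
      where
      meet-r⁻¹ : ∀ {a} → InDC H r a → meet a a ≡ meet a (r ⁻¹)
      meet-r⁻¹ {a} a∈HrH = meet-InDC (Equivalence.to (r-selfInverse a) a∈HrH)

    ∑-sq∈H : ∀ {θ} → IsThetaReps H θ → ∑[ x ] 𝟙 (x ∙ x ∈H?) ≡ length θ * order H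
    ∑-sq∈H {θ} (θ-selfInverse , θ-apart , θ-cover) = begin
      ∑[ x ] 𝟙 (x ∙ x ∈H?)
        ≡⟨ ∑-cong elements (λ x → sym (trans (𝟙-*-congˡ (unique-rep x) (x ∙ x ∈H?)) (*-identityʳ _))) ⟩
      ∑[ x ] 𝟙 (x ∙ x ∈H?) * (∑[ r ← θ ] 𝟙 (InDC? r x))
        ≡⟨ ∑-*ˡ-swap elements θ (λ x → 𝟙 (x ∙ x ∈H?)) (λ x r → 𝟙 (InDC? r x)) ⟩
      ∑[ r ← θ ] ∑[ x ] 𝟙 (x ∙ x ∈H?) * 𝟙 (InDC? r x)
        ≡⟨ ∑-const (All.map selfInverse⇒∑-sq∈H θ-selfInverse) ⟩
      length θ * order H
        ∎
      where
      unique-rep : ∀ x → x ∙ x ∈H → ∑[ r ← θ ] 𝟙 (InDC? r x) ≡ 1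
      unique-rep x xx∈H =
        ∑-𝟙-unique InDC? InDC-sym InDC-trans θ θ-apart (θ-cover x (sq∈H⇒selfInverse xx∈H))

theorem2 : (G : FiniteGroup) (H : Subgroup G)
           (cs : List (FiniteGroup.Carrier G)) → IsClassReps G cs →
           (θ : List (FiniteGroup.Carrier G)) → IsThetaReps H θ →
           order H * length θ ≡ sum (map (λ c → countHC H c * FiniteGroup.Sq G c) cs)
theorem2 G H cs cs-reps θ θ-reps = begin
  order H * length θ                        ≡⟨ *-comm (order H) (length θ) ⟩
  length θ * order H                        ≡⟨ ∑-sq∈H H θ-reps ⟨
  ∑[ x ] 𝟙 (member? (x ∙ x))                ≡⟨ ∑-fibres (λ x → x ∙ x) (λ h → 𝟙 (member? h)) ⟨
  ∑[ h ] 𝟙 (member? h) * Sq h               ≡⟨ ∑-classReps cs-reps member? Sq Sq-conj ⟨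
  sum (map (λ c → countHC H c * Sq c) cs)   ∎
  where
  open FiniteGroup G
  open Subgroup H using (member?)
  open Counting G
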